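{- Let $\eta:A^*\to A^*$ be a substitution and $u\in A^{\mathbb{Z}}$ a two-sided periodic point of $\eta$ with growing seed. Then the map $\mathrm{rep}_u:\mathbb{Z}\to\{0,1\}\mathcal{D}^*$ is increasing with respect to the order $\prec$ on $\{0,1\}\mathcal{D}^*$, i.e. $n<n'$ implies $\mathrm{rep}_u(n)\prec\mathrm{rep}_u(n')$.
   Context: $A$ is a finite alphabet, $A^*$ the finite words, $\varepsilon$ the empty word, $|w|$ the length. A substitution is a morphism $\eta:A^*\to A^*$ with $\eta(a)\neq\varepsilon$ for all $a$ and some letter growing ($|\eta^k(a)|\to\infty$). $\eta$ acts on $u\in A^{\mathbb{Z}}$ by $\eta(\cdots u_{ -1}|u_0\cdots)=\cdots\eta(u_{ -2})\eta(u_{ -1})|\eta(u_0)\eta(u_1)\cdots$ ($|$ separating positions $-1$ and $0$); $u$ is a periodic point if $\eta^p(u)=u$ for some $p\ge1$, its period is the least such $p$; the seed $u_{ -1}|u_0$ is growing if both letters are growing. A sequence $(m_i,a_i)_{i=0,\dots,k}$ in $A^*\times A$ is $x$-admissible if $m_{i-1}a_{i-1}$ is a prefix of $\eta(a_i)$ for $1\le i\le k$ and $m_ka_k$ is a prefix of $\eta(x)$. Let $\mathcal{D}=\{0,\dots,\max_c|\eta(c)|-1\}$; $\odot$ is concatenation of words over $\mathcal{D}$. Numeration system: with $p$ the period of $u$, for $n\ge1$ there are a unique $k$ divisible by $p$ and a unique $u_0$-admissible $(m_i,a_i)_{i=0,\dots,k-1}$ with $m_{k-1}\cdots m_{k-p}\ne\varepsilon$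 and $u_0\cdots u_{n-1}=\eta^{k-1}(m_{k-1})\cdots\eta^0(m_0)$; for $n\le-2$ there are a unique $k$ divisible by $p$ and a unique $u_{ -1}$-admissible $(m_i,a_i)_{i=0,\dots,k-1}$ with $\eta^{p-1}(m_{k-1})\cdots\eta^0(m_{k-p})a_{k-p}\ne\eta^p(u_{ -1})$ and $u_{ -|\eta^k(u_{ -1})|}\cdots u_{n-1}=\eta^{k-1}(m_{k-1})\cdots\eta^0(m_0)$. Then $\mathrm{rep}_u(n)=0\odot|m_{k-1}|\odot\cdots\odot|m_0|$ for $n\ge1$, $\mathrm{rep}_u(0)=0$, $\mathrm{rep}_u(-1)=1$, $\mathrm{rep}_u(n)=1\odot|m_{k-1}|\odot\cdots\odot|m_0|$ for $n\le-2$. Orders: $<_{lex}$ is lexicographic order on $\mathcal{D}^*$; $u<_{rad}v$ iff $|u|<|v|$, or $|u|=|v|$ and $u<_{lex}v$; $u<_{rev}v$ iff $|u|>|v|$, or $|u|=|v|$ and $u<_{lex}v$. For $u,v\in\{0,1\}\mathcal{D}^*$, $u\prec v$ iff ($u\in1\mathcal{D}^*$ and $v\in0\mathcal{D}^*$) or ($u,v\in0\mathcal{D}^*$ and $u<_{rad}v$) or ($u,v\in1\mathcal{D}^*$ and $u<_{rev}v$). -}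

module Defs where

open import Data.Nat as ℕ using (ℕ; zero; suc; _∸_; _≤_)
open import Data.Nat.Divisibility using (_∣_)
open import Relation.Nullary using (¬_)
open import Data.Integer as ℤ using (ℤ; +_; -[1+_]; -_; 0ℤ; 1ℤ)
open import Data.Fin using (Fin; toℕ)
open import Data.List using (List; []; _∷_; _++_; length; concatMap; lookup; [_])
open import Data.List.Relation.Binary.Lex.Strict using (Lex-<)
open import Data.Product using (Σ; ∃; _×_; _,_)
open import Data.Sum using (_⊎_)
open import Relation.Binary.PropositionalEquality using (_≡_; _≢_)

Word : ℕ → Set
Word s = List (Fin s)

Morph : ℕ → Set
Morph s = Fin s → Word s

applyW : ∀ {s} → Morph s → Word s → Word s
applyW σ w = concatMap σ w

powW : ∀ {s} → Morph s → ℕ → Word s → Word s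
powW σ zero    w = w
powW σ (suc k) w = applyW σ (powW σ k w)

powM : ∀ {s} → Morph s → ℕ → Morph s
powM σ k a = powW σ k [ a ]

Growing : ∀ {s} → Morph s → Fin s → Set
Growing η a = ∀ N → ∃ λ K → ∀ k → K ≤ k → N ≤ length (powM η k a)

record Substitution {s : ℕ} (η : Morph s) : Set where
  field
    nonErasing : ∀ a → η a ≢ []
    someGrowing : ∃ λ a → Growing η a

Seq : ℕ → Set
Seq s = ℤ → Fin s

segment : ∀ {s} → Seq s → ℤ → ℕ → Word s
segment u z zero    = []
segment u z (suc l) = u z ∷ segment u (z ℤ.+ 1ℤ) l

-- position in σ(u) at which the block σ(u_z) starts
-- (z ≥ 0 : |σ(u_0 ⋯ u_{z-1})| ;  z < 0 : -|σ(u_z ⋯ u_{-1})|)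
blockStart : ∀ {s} → Morph s → Seq s → ℤ → ℤ
blockStart σ u (+ j)     = + length (applyW σ (segment u 0ℤ j))
blockStart σ u -[1+ j ]  = - (+ length (applyW σ (segment u -[1+ j ] (suc j))))

-- v = σ(u) for the action ⋯σ(u_{-2})σ(u_{-1})|σ(u_0)σ(u_1)⋯
IsImage : ∀ {s} → Morph s → Seq s → Seq s → Set
IsImage σ u v = ∀ (z : ℤ) (i : Fin (length (σ (u z)))) →
  v (blockStart σ u z ℤ.+ + toℕ i) ≡ lookup (σ (u z)) i

IsFixedBy : ∀ {s} → Morph s → ℕ → Seq s → Set
IsFixedBy η p u = IsImage (powM η p) u u

Period : ∀ {s} → Morph s → Seq s → ℕ → Set
Period η u p = (1 ≤ p) × IsFixedBy η p u ×
  (∀ q → 1 ≤ q → q ℕ.< p → ¬ (IsFixedBy η q u))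

GrowingSeed : ∀ {s} → Morph s → Seq s → Set
GrowingSeed η u = Growing η (u -[1+ 0 ]) × Growing η (u 0ℤ)

Prefix : ∀ {s} → Word s → Word s → Set
Prefix x y = ∃ λ z → x ++ z ≡ y

-- (m_i, a_i)_{i = 0..k-1} is x-admissible (sequences given as ℕ-indexed
-- functions, only indices < k matter)
Admissible : ∀ {s} → Morph s → Fin s → ℕ → (ℕ → Word s) → (ℕ → Fin s) → Set
Admissible η x k m a =
  (∀ i → 1 ≤ i → suc i ℕ.≤ k → Prefix (m (i ∸ 1) ++ [ a (i ∸ 1) ]) (η (a i))) ×
  Prefix (m (k ∸ 1) ++ [ a (k ∸ 1) ]) (η x)

expand : ∀ {s} → Morph s → (ℕ → Word s) → ℕ → Word s
expand η m zero    = []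
expand η m (suc j) = powW η j (m j) ++ expand η m j

flatten : ∀ {s} → (ℕ → Word s) → ℕ → Word s
flatten m zero    = []
flatten m (suc j) = m j ++ flatten m j

digits : ∀ {s} → (ℕ → Word s) → ℕ → List ℕ
digits m zero    = []
digits m (suc j) = length (m j) ∷ digits m j

shift : ∀ {s} → (ℕ → Word s) → ℕ → (ℕ → Word s)
shift m t i = m (t ℕ.+ i)

data Rep {s : ℕ} (η : Morph s) (u : Seq s) (p : ℕ) : ℤ → List ℕ → Set where
  rep-zero : Rep η u p 0ℤ (0 ∷ [])
  rep-minus-one : Rep η u p -[1+ 0 ] (1 ∷ [])
  rep-pos : ∀ n k (m : ℕ → Word s) (a : ℕ → Fin s) →
    p ∣ k → 1 ≤ k →
    Admissible η (u 0ℤ) k m a →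
    flatten (shift m (k ∸ p)) p ≢ [] →
    segment u 0ℤ (suc n) ≡ expand η m k →
    Rep η u p (+ suc n) (0 ∷ digits m k)
  rep-neg : ∀ n k (m : ℕ → Word s) (a : ℕ → Fin s) →
    p ∣ k → 1 ≤ k →
    Admissible η (u -[1+ 0 ]) k m a →
    expand η (shift m (k ∸ p)) p ++ [ a (k ∸ p) ] ≢ powM η p (u -[1+ 0 ]) →
    -- u_{-L} ⋯ u_{n-1} = η^{k-1}(m_{k-1}) ⋯ η^0(m_0),  L = |η^k(u_{-1})|,
    -- written as: the factor of length |w| starting at -L is w, and -L + |w| = n
    segment u (- (+ length (powM η k (u -[1+ 0 ]))))
              (length (expand η m k)) ≡ expand η m k →
    - (+ length (powM η k (u -[1+ 0 ]))) ℤ.+ + length (expand η m k) ≡ -[1+ suc n ] →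
    Rep η u p -[1+ suc n ] (1 ∷ digits m k)

_<lex_ : List ℕ → List ℕ → Set
_<lex_ = Lex-< _≡_ ℕ._<_

_<rad_ : List ℕ → List ℕ → Set
x <rad y = (length x ℕ.< length y) ⊎ ((length x ≡ length y) × (x <lex y))

_<rev_ : List ℕ → List ℕ → Set
x <rev y = (length y ℕ.< length x) ⊎ ((length x ≡ length y) × (x <lex y))

data _≺_ : List ℕ → List ℕ → Set where
  neg<pos : ∀ x y → (1 ∷ x) ≺ (0 ∷ y)
  pos<pos : ∀ x y → (0 ∷ x) <rad (0 ∷ y) → (0 ∷ x) ≺ (0 ∷ y)
  neg<neg : ∀ x y → (1 ∷ x) <rev (1 ∷ y) → (1 ∷ x) ≺ (1 ∷ y)

-- The letters of an admissible sequence form a chain: m_{i-1} a_{i-1} is a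
-- prefix of η(a_i), hence η^{j-1}(m_{j-1}) ⋯ η^0(m_0) a_0 is a prefix of
-- η^j(a_j). So among expansions with the same number k of digits and the same
-- top letter, the lexicographic order of the digit strings is the order of the
-- lengths of the expansions, i.e. of the represented integers. Expansions with
-- different numbers of digits are separated by the periodic point: η^p(u₀)
-- begins with u₀, so |η^{qp}(u₀)| increases with q, and the normalisation
-- m_{k-1} ⋯ m_{k-p} ≠ ε makes an expansion with k digits at least |η^{k-p}(u₀)|
-- long, longer than any expansion with at most k - p digits. Symmetrically
-- η^p(u₋₁) ends with u₋₁, and on the negative side the normalisation makes the
-- part of η^k(u₋₁) not covered by the expansion longer than |η^{k-p}(u₋₁)|.
module Submission where

open import Data.Empty using (⊥-elim)
open import Data.Fin using (Fin; toℕ) renaming (zero to fzero; suc to fsuc)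
open import Data.Integer as ℤ using (ℤ; -[1+_]; _⊖_; 0ℤ; -<+; -<-; +<+)
open import Data.Integer.Properties using ([1+m]⊖[1+n]≡m⊖n; -m+n≡n⊖m)
open import Data.List using (List; []; _∷_; _++_; length; [_]; lookup; initLast; _∷ʳ′_)
open import Data.List.Properties
  using (length-++; ++-assoc; ++-identityʳ; ∷-injective; ∷ʳ-injective; ++-conicalˡ; ++-conicalʳ)
open import Data.List.Membership.Propositional using (_∈_)
open import Data.List.Membership.Propositional.Properties using (∈-∃++; ∈-++⁺ʳ)
open import Data.List.Relation.Binary.Lex.Strict using (base; this; next; <-compare)
open import Data.List.Relation.Binary.Pointwise using (Pointwise-≡⇒≡)
open import Data.List.Relation.Unary.Any using (here)
open import Data.Nat using (ℕ; zero; suc; _+_; _*_; _∸_; _≤_; _<_; _<?_; z≤n; s≤s)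
open import Data.Nat.Divisibility using (_∣_; divides; ∣m+n∣m⇒∣n)
open import Data.Nat.Properties
open import Data.Product using (∃; _×_; _,_)
open import Data.Sum using (inj₁; inj₂)
open import Function using (_∘_)
open import Relation.Binary.Definitions using (tri<; tri≈; tri>)
open import Relation.Binary.PropositionalEquality hiding ([_])
import Relation.Binary.Reasoning.Base.Single as SingleReasoning
open import Relation.Nullary using (yes; no)

open import Defs

module _ {s : ℕ} where

  prefix-refl : {x : Word s} → Prefix x x
  prefix-refl = [] , ++-identityʳ _

  prefix-trans : {x y w : Word s} → Prefix x y → Prefix y w → Prefix x w
  prefix-trans {x} (z , refl) (z′ , refl) = z ++ z′ , sym (++-assoc x z z′)

  module Prefix-Reasoning = SingleReasoning Prefix prefix-refl prefix-trans

  prefix-++ʳ : (x y : Word s) → Prefix x (x ++ y)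
  prefix-++ʳ x y = y , refl

  prefix-++ˡ : (w : Word s) {x y : Word s} → Prefix x y → Prefix (w ++ x) (w ++ y)
  prefix-++ˡ w {x} (z , refl) = z , ++-assoc w x z

  prefix-length : {x y : Word s} → Prefix x y → length x ≤ length y
  prefix-length {x} (z , refl) = subst (length x ≤_) (sym (length-++ x)) (m≤m+n _ _)

  prefix-length-≡⇒≡ : {x y : Word s} → Prefix x y → length x ≡ length y → x ≡ y
  prefix-length-≡⇒≡ {x} ([] , refl) _ = sym (++-identityʳ x)
  prefix-length-≡⇒≡ {x} (c ∷ z , refl) len = ⊥-elim (m+1+n≢m (length x) (sym (trans len (length-++ x))))

  ++-≡-shorter⇒prefix : (x z y z′ : Word s) → x ++ z ≡ y ++ z′ → length x ≤ length y → Prefix x y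
  ++-≡-shorter⇒prefix []      z y       z′ _ _         = y , refl
  ++-≡-shorter⇒prefix (c ∷ x) z (d ∷ y) z′ e (s≤s len) with refl , e′ ← ∷-injective e =
    let r , r≡ = ++-≡-shorter⇒prefix x z y z′ e′ len in r , cong (c ∷_) r≡

  prefixes-comparable : {x y w : Word s} → Prefix x w → Prefix y w → length x ≤ length y → Prefix x y
  prefixes-comparable {x} {y} (z , e) (z′ , e′) = ++-≡-shorter⇒prefix x z y z′ (trans e (sym e′))

  ∷ʳ-prefixes-same-length : {x y w : Word s} {c d : Fin s} →
    Prefix (x ++ [ c ]) w → Prefix (y ++ [ d ]) w → length x ≡ length y → x ≡ y × c ≡ d
  ∷ʳ-prefixes-same-length {x} {y} xc⊑w yd⊑w len = ∷ʳ-injective x y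
    (prefix-length-≡⇒≡ (prefixes-comparable xc⊑w yd⊑w (≤-reflexive len′)) len′)
    where
    len′ : length (x ++ _) ≡ length (y ++ _)
    len′ = trans (length-++ x) (trans (cong (_+ 1) len) (sym (length-++ y)))

  ∷ʳ-prefixes-shorter : {x y w : Word s} {c d : Fin s} →
    Prefix (x ++ [ c ]) w → Prefix (y ++ [ d ]) w → length x < length y → Prefix (x ++ [ c ]) y
  ∷ʳ-prefixes-shorter {x} {y} xc⊑w yd⊑w len =
    prefixes-comparable xc⊑w (prefix-trans (prefix-++ʳ y _) yd⊑w)
      (subst (_≤ length y) (sym (trans (length-++ x) (+-comm _ 1))) len)

  ≢[]⇒1≤length : {w : Word s} → w ≢ [] → 1 ≤ length w
  ≢[]⇒1≤length {[]}    w≢[] = ⊥-elim (w≢[] refl)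
  ≢[]⇒1≤length {_ ∷ _} _    = s≤s z≤n

  prefix-∷-head : {w r : Word s} {x : Fin s} → Prefix w (x ∷ r) → w ≢ [] → Prefix [ x ] w
  prefix-∷-head {[]}    _          w≢[] = ⊥-elim (w≢[] refl)
  prefix-∷-head {c ∷ w} (_ , refl) _    = w , refl

  last-from-lookup : (w : Word s) (y : Fin s) → w ≢ [] →
    ((i : Fin (length w)) → toℕ i ≡ length w ∸ 1 → y ≡ lookup w i) → ∃ λ r → w ≡ r ++ [ y ]
  last-from-lookup []          y w≢[] _ = ⊥-elim (w≢[] refl)
  last-from-lookup (c ∷ [])    y _    f = [] , cong [_] (sym (f fzero refl))
  last-from-lookup (c ∷ d ∷ w) y _    f =
    let r , r≡ = last-from-lookup (d ∷ w) y (λ ()) (λ i e → f (fsuc i) (cong suc e))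
    in c ∷ r , cong (c ∷_) r≡

length-segment≡ : ∀ {s} {u : Seq s} {z : ℤ} {l : ℕ} {w : Word s} → segment u z l ≡ w → length w ≡ l
length-segment≡ {u = u} {z} {zero}  refl = refl
length-segment≡ {u = u} {z} {suc l} refl = cong suc (length-segment≡ {u = u} {z ℤ.+ ℤ.1ℤ} {l} refl)

length-digits : ∀ {s} (m : ℕ → Word s) k → length (digits m k) ≡ k
length-digits m zero    = refl
length-digits m (suc k) = cong suc (length-digits m k)

0<length-digits : ∀ {s} (m : ℕ → Word s) {k} → 0 < k → 0 < length (digits m k)
0<length-digits m {k} = subst (0 <_) (sym (length-digits m k))

length-digits-< : ∀ {s} {m m′ : ℕ → Word s} {k k′} → k < k′ → length (digits m k) < length (digits m′ k′)
length-digits-< {m = m} {m′} {k} {k′} = subst₂ _<_ (sym (length-digits m k)) (sym (length-digits m′ k′))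

length-digits-≡ : ∀ {s} (m m′ : ℕ → Word s) k → length (digits m k) ≡ length (digits m′ k)
length-digits-≡ m m′ k = trans (length-digits m k) (sym (length-digits m′ k))

multiple-gap : ∀ {p i j} → p ∣ i → p ∣ j → i < j → ∃ λ q → j ≡ (i + q * p) + p
multiple-gap {p} {i} {j} p∣i p∣j i<j
  with ∣m+n∣m⇒∣n (subst (p ∣_) (sym (m+[n∸m]≡n (<⇒≤ i<j))) p∣j) p∣i
... | divides zero    d≡0 = ⊥-elim (<⇒≢ (m<n⇒0<n∸m i<j) (sym d≡0))
... | divides (suc q) d≡  = q , (begin
  j                  ≡⟨ m+[n∸m]≡n (<⇒≤ i<j) ⟨
  i + (j ∸ i)        ≡⟨ cong (i +_) d≡ ⟩
  i + (p + q * p)    ≡⟨ cong (i +_) (+-comm p (q * p)) ⟩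
  i + (q * p + p)    ≡⟨ +-assoc i (q * p) p ⟨
  (i + q * p) + p    ∎)
  where open ≡-Reasoning

m+n≡o+p∧p<n⇒m<o : ∀ {m n o p} → m + n ≡ o + p → p < n → m < o
m+n≡o+p∧p<n⇒m<o {m} {n} {o} e p<n = +-cancelʳ-< n m o (subst (_< o + n) (sym e) (+-monoʳ-< o p<n))

⊖≡-[1+]⇒+ : ∀ m n {j} → m ⊖ n ≡ -[1+ j ] → m + suc j ≡ n
⊖≡-[1+]⇒+ m       zero    ()
⊖≡-[1+]⇒+ zero    (suc n) refl = refl
⊖≡-[1+]⇒+ (suc m) (suc n) e    = cong suc (⊖≡-[1+]⇒+ m n (trans (sym ([1+m]⊖[1+n]≡m⊖n m n)) e))

-m+n≡-[1+j]⇒n+1+j≡m : ∀ m n {j} → ℤ.- (ℤ.+ m) ℤ.+ ℤ.+ n ≡ -[1+ j ] → n + suc j ≡ m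
-m+n≡-[1+j]⇒n+1+j≡m m n e = ⊖≡-[1+]⇒+ n m (trans (sym (-m+n≡n⊖m m n)) e)

n⊖1+n≡-1 : ∀ n → n ⊖ suc n ≡ -[1+ 0 ]
n⊖1+n≡-1 zero    = refl
n⊖1+n≡-1 (suc n) = trans ([1+m]⊖[1+n]≡m⊖n n (suc n)) (n⊖1+n≡-1 n)

-m+[m∸1]≡-1 : ∀ m → 1 ≤ m → ℤ.- (ℤ.+ m) ℤ.+ ℤ.+ (m ∸ 1) ≡ -[1+ 0 ]
-m+[m∸1]≡-1 (suc m) _ = trans (-m+n≡n⊖m (suc m) m) (n⊖1+n≡-1 m)

module _ {s : ℕ} (η : Morph s) where

  applyW-++ : (x y : Word s) → applyW η (x ++ y) ≡ applyW η x ++ applyW η y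
  applyW-++ []      y = refl
  applyW-++ (a ∷ x) y = trans (cong (η a ++_) (applyW-++ x y)) (sym (++-assoc (η a) _ _))

  powW-++ : ∀ j (x y : Word s) → powW η j (x ++ y) ≡ powW η j x ++ powW η j y
  powW-++ zero    x y = refl
  powW-++ (suc j) x y = trans (cong (applyW η) (powW-++ j x y)) (applyW-++ (powW η j x) (powW η j y))

  powW-[] : ∀ j → powW η j [] ≡ []
  powW-[] zero    = refl
  powW-[] (suc j) = cong (applyW η) (powW-[] j)

  powW-+ : ∀ i j (w : Word s) → powW η (i + j) w ≡ powW η i (powW η j w)
  powW-+ zero    j w = refl
  powW-+ (suc i) j w = cong (applyW η) (powW-+ i j w)

  powW-suc : ∀ j (c : Fin s) → powW η (suc j) [ c ] ≡ powW η j (η c)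
  powW-suc j c = begin
    powW η (suc j) [ c ]  ≡⟨ cong (λ i → powW η i [ c ]) (+-comm 1 j) ⟩
    powW η (j + 1) [ c ]  ≡⟨ powW-+ j 1 [ c ] ⟩
    powW η j (η c ++ [])  ≡⟨ cong (powW η j) (++-identityʳ (η c)) ⟩
    powW η j (η c)        ∎
    where open ≡-Reasoning

  powW-prefix : ∀ j {x y : Word s} → Prefix x y → Prefix (powW η j x) (powW η j y)
  powW-prefix j {x} (z , refl) = powW η j z , sym (powW-++ j x z)

  powW-≢[] : (∀ c → η c ≢ []) → ∀ j {w : Word s} → w ≢ [] → powW η j w ≢ []
  powW-≢[] nonErasing zero    w≢[] = w≢[]
  powW-≢[] nonErasing (suc j) {w} w≢[] with powW η j w | powW-≢[] nonErasing j w≢[]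
  ... | []    | ηʲw≢[] = ⊥-elim (ηʲw≢[] refl)
  ... | c ∷ _ | _      = nonErasing c ∘ ++-conicalˡ (η c) _

  powW≡[]⇒≡[] : (∀ c → η c ≢ []) → ∀ j {w : Word s} → powW η j w ≡ [] → w ≡ []
  powW≡[]⇒≡[] nonErasing j {[]}    _ = refl
  powW≡[]⇒≡[] nonErasing j {c ∷ w} e = ⊥-elim (powW-≢[] nonErasing j (λ ()) e)

  expand≡[]⇒flatten≡[] : (∀ c → η c ≢ []) → ∀ (m : ℕ → Word s) j → expand η m j ≡ [] → flatten m j ≡ []
  expand≡[]⇒flatten≡[] nonErasing m zero    _ = refl
  expand≡[]⇒flatten≡[] nonErasing m (suc j) e = cong₂ _++_
    (powW≡[]⇒≡[] nonErasing j (++-conicalˡ _ _ e)) (expand≡[]⇒flatten≡[] nonErasing m j (++-conicalʳ _ _ e))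

  expand-+ : ∀ (m : ℕ → Word s) t j → expand η m (t + j) ≡ powW η t (expand η (shift m t) j) ++ expand η m t
  expand-+ m t zero = begin
    expand η m (t + 0)                ≡⟨ cong (expand η m) (+-identityʳ t) ⟩
    expand η m t                      ≡⟨ cong (_++ expand η m t) (powW-[] t) ⟨
    powW η t [] ++ expand η m t       ∎
    where open ≡-Reasoning
  expand-+ m t (suc j) = begin
    expand η m (t + suc j)                                ≡⟨ cong (expand η m) (+-suc t j) ⟩
    powW η (t + j) (m (t + j)) ++ expand η m (t + j)       ≡⟨ cong (powW η (t + j) (m (t + j)) ++_) (expand-+ m t j) ⟩
    powW η (t + j) (m (t + j)) ++ (powW η t E ++ expand η m t)    ≡⟨ ++-assoc (powW η (t + j) (m (t + j))) (powW η t E) (expand η m t) ⟨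
    (powW η (t + j) (m (t + j)) ++ powW η t E) ++ expand η m t    ≡⟨ cong (λ w → (w ++ powW η t E) ++ expand η m t) (powW-+ t j (m (t + j))) ⟩
    (powW η t (powW η j (m (t + j))) ++ powW η t E) ++ expand η m t ≡⟨ cong (_++ expand η m t) (powW-++ t _ E) ⟨
    powW η t (powW η j (m (t + j)) ++ E) ++ expand η m t  ∎
    where
    open ≡-Reasoning
    E = expand η (shift m t) j

  lenPow : ℕ → Word s → ℕ
  lenPow j w = length (powW η j w)

  lenPow-++ : ∀ j (x y : Word s) → lenPow j (x ++ y) ≡ lenPow j x + lenPow j y
  lenPow-++ j x y = trans (cong length (powW-++ j x y)) (length-++ (powW η j x))

  lenPow-prefix : ∀ j {x y : Word s} → Prefix x y → lenPow j x ≤ lenPow j y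
  lenPow-prefix j x⊑y = prefix-length (powW-prefix j x⊑y)

  length-expand-+ : ∀ (m : ℕ → Word s) t j →
    length (expand η m (t + j)) ≡ lenPow t (expand η (shift m t) j) + length (expand η m t)
  length-expand-+ m t j = trans (cong length (expand-+ m t j)) (length-++ (powW η t _))

  length-expand-suc : ∀ (m : ℕ → Word s) i → length (expand η m (suc i)) ≡ lenPow i (m i) + length (expand η m i)
  length-expand-suc m i = length-++ (powW η i (m i))

  lenPow-∈ : ∀ i {y : Fin s} {w : Word s} → y ∈ w → lenPow i [ y ] ≤ lenPow i w
  lenPow-∈ i y∈w with ∈-∃++ y∈w
  ... | A , B , refl = begin
    lenPow i [ _ ]                       ≤⟨ m≤m+n _ _ ⟩
    lenPow i [ _ ] + lenPow i B          ≡⟨ lenPow-++ i [ _ ] B ⟨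
    lenPow i ([ _ ] ++ B)                ≤⟨ m≤n+m _ _ ⟩
    lenPow i A + lenPow i ([ _ ] ++ B)   ≡⟨ lenPow-++ i A _ ⟨
    lenPow i (A ++ [ _ ] ++ B)           ∎
    where open ≤-Reasoning

  lenPow-mono-multiples : ∀ {p} {x : Fin s} → x ∈ powW η p [ x ] → ∀ i q → lenPow i [ x ] ≤ lenPow (i + q * p) [ x ]
  lenPow-mono-multiples {p} {x} x∈ i zero    = ≤-reflexive (cong (λ j → lenPow j [ x ]) (sym (+-identityʳ i)))
  lenPow-mono-multiples {p} {x} x∈ i (suc q) = begin
    lenPow i [ x ]                     ≤⟨ lenPow-mono-multiples x∈ i q ⟩
    lenPow (i + q * p) [ x ]           ≤⟨ lenPow-∈ (i + q * p) x∈ ⟩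
    lenPow (i + q * p) (powW η p [ x ]) ≡⟨ cong length (powW-+ (i + q * p) p [ x ]) ⟨
    lenPow ((i + q * p) + p) [ x ]      ≡⟨ cong (λ j → lenPow j [ x ]) (trans (+-assoc i (q * p) p) (cong (i +_) (+-comm (q * p) p))) ⟩
    lenPow (i + suc q * p) [ x ]        ∎
    where open ≤-Reasoning

  lenPow-proper-prefix-∷ʳ : ∀ t {w r : Word s} {x : Fin s} → Prefix w (r ++ [ x ]) → w ≢ r ++ [ x ] →
    lenPow t w + lenPow t [ x ] ≤ lenPow t (r ++ [ x ])
  lenPow-proper-prefix-∷ʳ t {w} {r} (z , e) w≢ with initLast z
  ... | []       = ⊥-elim (w≢ (trans (sym (++-identityʳ w)) e))
  ... | z′ ∷ʳ′ y with _ , refl ← ∷ʳ-injective (w ++ z′) r (trans (++-assoc w z′ [ y ]) e) = begin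
    lenPow t w + lenPow t [ y ]                ≤⟨ +-monoˡ-≤ (lenPow t [ y ]) (m≤m+n (lenPow t w) (lenPow t z′)) ⟩
    (lenPow t w + lenPow t z′) + lenPow t [ y ] ≡⟨ cong (_+ lenPow t [ y ]) (lenPow-++ t w z′) ⟨
    lenPow t (w ++ z′) + lenPow t [ y ]        ≡⟨ lenPow-++ t (w ++ z′) [ y ] ⟨
    lenPow t ((w ++ z′) ++ [ y ])              ≡⟨ cong (lenPow t) (trans (++-assoc w z′ [ y ]) e) ⟩
    lenPow t (r ++ [ y ])                      ∎
    where open ≤-Reasoning

  -- Admissible sequences as chains

  Chain : (ℕ → Word s) → (ℕ → Fin s) → ℕ → Set
  Chain m b k = ∀ i → i < k → Prefix (m i ++ [ b i ]) (η (b (suc i)))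

  chain-prefix : ∀ {m b k} → Chain m b k → ∀ t j → t + j ≤ k →
    Prefix (expand η (shift m t) j ++ [ b t ]) (powW η j [ b (t + j) ])
  chain-prefix {b = b} ch t zero _ = subst (λ i → Prefix [ b t ] [ b i ]) (sym (+-identityʳ t)) prefix-refl
  chain-prefix {m} {b} {k} ch t (suc j) t+j<k = begin
    (powW η j (m (t + j)) ++ E) ++ [ b t ]          ≡⟨ ++-assoc (powW η j (m (t + j))) E [ b t ] ⟩
    powW η j (m (t + j)) ++ (E ++ [ b t ])          ∼⟨ prefix-++ˡ (powW η j (m (t + j))) (chain-prefix ch t j (<⇒≤ t+j<k′)) ⟩
    powW η j (m (t + j)) ++ powW η j [ b (t + j) ]  ≡⟨ powW-++ j (m (t + j)) [ b (t + j) ] ⟨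
    powW η j (m (t + j) ++ [ b (t + j) ])           ∼⟨ powW-prefix j (ch (t + j) t+j<k′) ⟩
    powW η j (η (b (suc (t + j))))                  ≡⟨ powW-suc j (b (suc (t + j))) ⟨
    powW η (suc j) [ b (suc (t + j)) ]              ≡⟨ cong (λ i → powW η (suc j) [ b i ]) (+-suc t j) ⟨
    powW η (suc j) [ b (t + suc j) ]                ∎
    where
    open Prefix-Reasoning
    E = expand η (shift m t) j
    t+j<k′ : t + j < k
    t+j<k′ = subst (_≤ k) (+-suc t j) t+j<k

  chain-expand-shorter : ∀ {m b k} → Chain m b k → ∀ j → j ≤ k → length (expand η m j) < lenPow j [ b j ]
  chain-expand-shorter {m} {b} ch j j≤k = subst (_≤ lenPow j [ b j ])
    (trans (length-++ (expand η m j)) (+-comm _ 1)) (prefix-length (chain-prefix ch 0 j j≤k))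

  -- a_0, …, a_{k-1} followed by a_k := x, so that the last condition of admissibility
  -- becomes one more link of the chain.
  withTop : ℕ → (ℕ → Fin s) → Fin s → ℕ → Fin s
  withTop k a x i with i <? k
  ... | yes _ = a i
  ... | no  _ = x

  withTop-< : ∀ {k a x i} → i < k → withTop k a x i ≡ a i
  withTop-< {k} {i = i} i<k with i <? k
  ... | yes _   = refl
  ... | no  i≮k = ⊥-elim (i≮k i<k)

  withTop-top : ∀ k a x → withTop k a x k ≡ x
  withTop-top k a x with k <? k
  ... | yes k<k = ⊥-elim (<-irrefl refl k<k)
  ... | no  _   = refl

  admissible⇒chain : ∀ {x k m a} → Admissible η x k m a → Chain m (withTop k a x) k
  admissible⇒chain {x} {k} {m} {a} (below , top) i i<k with suc i <? k
  ... | yes 1+i<k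
    rewrite withTop-< {k} {a} {x} (<-trans (n<1+n i) 1+i<k)
    = below (suc i) (s≤s z≤n) 1+i<k
  ... | no 1+i≮k with refl ← ≤-antisym i<k (≮⇒≥ 1+i≮k)
    rewrite withTop-< {suc i} {a} {x} (n<1+n i)
    = top

  admissible-prefix : ∀ {x k m a} → Admissible η x k m a → ∀ t j → 1 ≤ j → t + j ≡ k →
    Prefix (expand η (shift m t) j ++ [ a t ]) (powW η j [ x ])
  admissible-prefix {x} {k} {m} {a} adm t j 1≤j refl =
    subst₂ (λ c d → Prefix (expand η (shift m t) j ++ [ c ]) (powW η j [ d ]))
      (withTop-< (m<m+n t 1≤j)) (withTop-top k a x)
      (chain-prefix {m} {withTop k a x} (admissible⇒chain {x} {k} {m} {a} adm) t j ≤-refl)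

  admissible-expand-shorter : ∀ {x k m a} → Admissible η x k m a → length (expand η m k) < lenPow k [ x ]
  admissible-expand-shorter {x} {k} {m} {a} adm =
    subst (λ c → length (expand η m k) < lenPow k [ c ]) (withTop-top k a x)
      (chain-expand-shorter {m} {withTop k a x} (admissible⇒chain {x} {k} {m} {a} adm) k ≤-refl)

  admissible-expand-shorter-below : ∀ {x k m a} → Admissible η x k m a → ∀ t → t < k →
    length (expand η m t) < lenPow t [ a t ]
  admissible-expand-shorter-below {x} {k} {m} {a} adm t t<k =
    subst (λ c → length (expand η m t) < lenPow t [ c ]) (withTop-< t<k)
      (chain-expand-shorter {m} {withTop k a x} (admissible⇒chain {x} {k} {m} {a} adm) t (<⇒≤ t<k))

  module _ {m m′ : ℕ → Word s} {b b′ : ℕ → Fin s} {k : ℕ} (ch : Chain m b k) (ch′ : Chain m′ b′ k) where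

    private
      common-prefix : ∀ i → i < k → b (suc i) ≡ b′ (suc i) → Prefix (m′ i ++ [ b′ i ]) (η (b (suc i)))
      common-prefix i i<k e = subst (λ c → Prefix (m′ i ++ [ b′ i ]) (η c)) (sym e) (ch′ i i<k)

    digits-≡⇒expand-≡ : ∀ j → j ≤ k → b j ≡ b′ j → digits m j ≡ digits m′ j → expand η m j ≡ expand η m′ j
    digits-≡⇒expand-≡ zero    _   _ _  = refl
    digits-≡⇒expand-≡ (suc i) i<k e ds
      with len , ds′ ← ∷-injective ds
      with mᵢ≡ , bᵢ≡ ← ∷ʳ-prefixes-same-length (ch i i<k) (common-prefix i i<k e) len =
      cong₂ (λ w v → powW η i w ++ v) mᵢ≡ (digits-≡⇒expand-≡ i (<⇒≤ i<k) bᵢ≡ ds′)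

    digits-<lex⇒expand-length-< : ∀ j → j ≤ k → b j ≡ b′ j → digits m j <lex digits m′ j →
      length (expand η m j) < length (expand η m′ j)
    digits-<lex⇒expand-length-< zero    _   _ (base ())
    digits-<lex⇒expand-length-< (suc i) i<k e (this len<) = begin-strict
      length (expand η m (suc i))               ≡⟨ length-expand-suc m i ⟩
      lenPow i (m i) + length (expand η m i)    <⟨ +-monoʳ-< (lenPow i (m i)) (chain-expand-shorter ch i (<⇒≤ i<k)) ⟩
      lenPow i (m i) + lenPow i [ b i ]         ≡⟨ lenPow-++ i (m i) [ b i ] ⟨
      lenPow i (m i ++ [ b i ])                 ≤⟨ lenPow-prefix i (∷ʳ-prefixes-shorter (ch i i<k) (common-prefix i i<k e) len<) ⟩
      lenPow i (m′ i)                           ≤⟨ m≤m+n _ _ ⟩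
      lenPow i (m′ i) + length (expand η m′ i)  ≡⟨ length-expand-suc m′ i ⟨
      length (expand η m′ (suc i))              ∎
      where open ≤-Reasoning
    digits-<lex⇒expand-length-< (suc i) i<k e (next len ds<)
      with mᵢ≡ , bᵢ≡ ← ∷ʳ-prefixes-same-length (ch i i<k) (common-prefix i i<k e) len = begin-strict
      length (expand η m (suc i))               ≡⟨ length-expand-suc m i ⟩
      lenPow i (m i) + length (expand η m i)    <⟨ +-monoʳ-< (lenPow i (m i)) (digits-<lex⇒expand-length-< i (<⇒≤ i<k) bᵢ≡ ds<) ⟩
      lenPow i (m i) + length (expand η m′ i)   ≡⟨ cong (λ w → lenPow i w + length (expand η m′ i)) mᵢ≡ ⟩
      lenPow i (m′ i) + length (expand η m′ i)  ≡⟨ length-expand-suc m′ i ⟨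
      length (expand η m′ (suc i))              ∎
      where open ≤-Reasoning

  expand-length-<⇒digits-<lex : ∀ {m m′ b b′ k} → Chain m b k → Chain m′ b′ k → b k ≡ b′ k →
    length (expand η m k) < length (expand η m′ k) → digits m k <lex digits m′ k
  expand-length-<⇒digits-<lex {m} {m′} {k = k} ch ch′ tops E<E′ with <-compare sym <-cmp (digits m k) (digits m′ k)
  ... | tri< ds< _ _ = ds<
  ... | tri≈ _ ds≈ _ = ⊥-elim (<-irrefl (cong length (digits-≡⇒expand-≡ ch ch′ k ≤-refl tops (Pointwise-≡⇒≡ ds≈))) E<E′)
  ... | tri> _ _ ds> = ⊥-elim (<-asym E<E′ (digits-<lex⇒expand-length-< ch′ ch k ≤-refl (sym tops) ds>))

  admissible-expand-length-<⇒digits-<lex : ∀ {x k m a m′ a′} → Admissible η x k m a → Admissible η x k m′ a′ →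
    length (expand η m k) < length (expand η m′ k) → digits m k <lex digits m′ k
  admissible-expand-length-<⇒digits-<lex {x} {k} {m} {a} {m′} {a′} adm adm′ =
    expand-length-<⇒digits-<lex (admissible⇒chain {x} {k} {m} {a} adm) (admissible⇒chain {x} {k} {m′} {a′} adm′)
      (trans (withTop-top k a x) (sym (withTop-top k a′ x)))

  -- Expansions with different numbers of digits

  expand-length-<-of-higher : ∀ {p x k m a k′ m′ a′} → (∀ c → η c ≢ []) → 1 ≤ p →
    (∃ λ r → powW η p [ x ] ≡ x ∷ r) → p ∣ k → p ∣ k′ → k′ < k →
    Admissible η x k m a → flatten (shift m (k ∸ p)) p ≢ [] → Admissible η x k′ m′ a′ →
    length (expand η m′ k′) < length (expand η m k)
  expand-length-<-of-higher {p} {x} {k} {m} {a} {k′} {m′} nonErasing 1≤p (r , head) p∣k p∣k′ k′<k adm normalised adm′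
    with q , refl ← multiple-gap p∣k′ p∣k k′<k = begin-strict
    length (expand η m′ k′)             <⟨ admissible-expand-shorter adm′ ⟩
    lenPow k′ [ x ]                     ≤⟨ lenPow-mono-multiples (subst (x ∈_) (sym head) (here refl)) k′ q ⟩
    lenPow t [ x ]                      ≤⟨ lenPow-prefix t x⊑P ⟩
    lenPow t P                          ≤⟨ m≤m+n _ _ ⟩
    lenPow t P + length (expand η m t)  ≡⟨ length-expand-+ m t p ⟨
    length (expand η m (t + p))         ∎
    where
    open ≤-Reasoning
    t = k′ + q * p
    P = expand η (shift m t) p
    P≢[] : P ≢ []
    P≢[] = subst (λ i → flatten (shift m i) p ≢ []) (m+n∸n≡m t p) normalised
         ∘ expand≡[]⇒flatten≡[] nonErasing (shift m t) p
    x⊑P : Prefix [ x ] P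
    x⊑P = prefix-∷-head (prefix-trans (prefix-++ʳ P _) (subst (Prefix _) head (admissible-prefix {m = m} adm t p 1≤p refl))) P≢[]

  lenPow+length-expand-<-of-higher : ∀ {p x k k′ m′ a′} → 1 ≤ p → (∃ λ r → powW η p [ x ] ≡ r ++ [ x ]) →
    p ∣ k → p ∣ k′ → k < k′ → Admissible η x k′ m′ a′ →
    expand η (shift m′ (k′ ∸ p)) p ++ [ a′ (k′ ∸ p) ] ≢ powW η p [ x ] →
    lenPow k [ x ] + length (expand η m′ k′) < lenPow k′ [ x ]
  lenPow+length-expand-<-of-higher {p} {x} {k} {k′} {m′} {a′} 1≤p (r , last) p∣k p∣k′ k<k′ adm′ normalised
    with q , refl ← multiple-gap p∣k p∣k′ k<k′ = begin-strict
    lenPow k [ x ] + length (expand η m′ (t + p))            ≡⟨ cong (lenPow k [ x ] +_) (length-expand-+ m′ t p) ⟩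
    lenPow k [ x ] + (lenPow t P + length (expand η m′ t))   <⟨ +-monoʳ-< (lenPow k [ x ]) (+-monoʳ-< (lenPow t P)
                                                                  (admissible-expand-shorter-below adm′ t (m<m+n t 1≤p))) ⟩
    lenPow k [ x ] + (lenPow t P + lenPow t [ c ])           ≡⟨ cong (lenPow k [ x ] +_) (lenPow-++ t P [ c ]) ⟨
    lenPow k [ x ] + lenPow t (P ++ [ c ])                   ≤⟨ +-monoˡ-≤ (lenPow t (P ++ [ c ])) (lenPow-mono-multiples x∈ k q) ⟩
    lenPow t [ x ] + lenPow t (P ++ [ c ])                   ≡⟨ +-comm (lenPow t [ x ]) _ ⟩
    lenPow t (P ++ [ c ]) + lenPow t [ x ]                   ≤⟨ lenPow-proper-prefix-∷ʳ t (subst (Prefix _) last Pc⊑)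
                                                                  (λ e → Pc≢ (trans e (sym last))) ⟩
    lenPow t (r ++ [ x ])                                    ≡⟨ cong (lenPow t) last ⟨
    lenPow t (powW η p [ x ])                                ≡⟨ cong length (powW-+ t p [ x ]) ⟨
    lenPow (t + p) [ x ]                                     ∎
    where
    open ≤-Reasoning
    t = k + q * p
    P = expand η (shift m′ t) p
    c = a′ t
    x∈ : x ∈ powW η p [ x ]
    x∈ = subst (x ∈_) (sym last) (∈-++⁺ʳ r (here refl))
    Pc⊑ : Prefix (P ++ [ c ]) (powW η p [ x ])
    Pc⊑ = admissible-prefix {m = m′} adm′ t p 1≤p refl
    Pc≢ : P ++ [ c ] ≢ powW η p [ x ]
    Pc≢ = subst (λ i → expand η (shift m′ i) p ++ [ a′ i ] ≢ powW η p [ x ]) (m+n∸n≡m t p) normalised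

  positive-digits-≺ : ∀ {p x k m a k′ m′ a′} → (∀ c → η c ≢ []) → 1 ≤ p →
    (∃ λ r → powW η p [ x ] ≡ x ∷ r) → p ∣ k → p ∣ k′ →
    Admissible η x k m a → flatten (shift m (k ∸ p)) p ≢ [] → Admissible η x k′ m′ a′ →
    length (expand η m k) < length (expand η m′ k′) → (0 ∷ digits m k) ≺ (0 ∷ digits m′ k′)
  positive-digits-≺ {k = k} {m} {k′ = k′} {m′} nonErasing 1≤p head p∣k p∣k′ adm normalised adm′ E<E′
    with <-cmp k k′
  ... | tri< k<k′ _ _ = pos<pos _ _ (inj₁ (s≤s (length-digits-< k<k′)))
  ... | tri≈ _ refl _ = pos<pos _ _ (inj₂ (cong suc (length-digits-≡ m m′ k) ,
                          next refl (admissible-expand-length-<⇒digits-<lex adm adm′ E<E′)))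
  ... | tri> _ _ k′<k = ⊥-elim (<-asym E<E′
                          (expand-length-<-of-higher nonErasing 1≤p head p∣k p∣k′ k′<k adm normalised adm′))

  negative-digits-≺ : ∀ {p x k m a k′ m′ a′ N N′} → 1 ≤ p →
    (∃ λ r → powW η p [ x ] ≡ r ++ [ x ]) → p ∣ k → p ∣ k′ →
    Admissible η x k m a → Admissible η x k′ m′ a′ →
    expand η (shift m′ (k′ ∸ p)) p ++ [ a′ (k′ ∸ p) ] ≢ powW η p [ x ] →
    length (expand η m k) + N ≡ lenPow k [ x ] → length (expand η m′ k′) + N′ ≡ lenPow k′ [ x ] → N′ < N →
    (1 ∷ digits m k) ≺ (1 ∷ digits m′ k′)
  negative-digits-≺ {x = x} {k} {m} {k′ = k′} {m′} {N = N} {N′} 1≤p last p∣k p∣k′ adm adm′ normalised E+N E′+N′ N′<N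
    with <-cmp k k′
  ... | tri> _ _ k′<k = neg<neg _ _ (inj₁ (s≤s (length-digits-< k′<k)))
  ... | tri≈ _ refl _ = neg<neg _ _ (inj₂ (cong suc (length-digits-≡ m m′ k) ,
                          next refl (admissible-expand-length-<⇒digits-<lex adm adm′
                            (m+n≡o+p∧p<n⇒m<o (trans E+N (sym E′+N′)) N′<N))))
  ... | tri< k<k′ _ _ = ⊥-elim (<-irrefl refl (begin-strict
    E′ + N′               <⟨ +-monoʳ-< E′ N′<N ⟩
    E′ + N                ≤⟨ +-monoʳ-≤ E′ (m≤n+m N _) ⟩
    E′ + (_ + N)          ≡⟨ cong (E′ +_) E+N ⟩
    E′ + lenPow k [ x ]   ≡⟨ +-comm E′ _ ⟩
    lenPow k [ x ] + E′   <⟨ lenPow+length-expand-<-of-higher 1≤p last p∣k p∣k′ k<k′ adm′ normalised ⟩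
    lenPow k′ [ x ]       ≡⟨ E′+N′ ⟨
    E′ + N′               ∎))
    where
    open ≤-Reasoning
    E′ = length (expand η m′ k′)

module _ {s : ℕ} {η : Morph s} {p : ℕ} {u : Seq s} (nonErasing : ∀ c → η c ≢ []) (fixed : IsFixedBy η p u) where

  fixed-point-head : ∃ λ r → powW η p [ u 0ℤ ] ≡ u 0ℤ ∷ r
  fixed-point-head = head (powW η p [ u 0ℤ ]) (powW-≢[] η nonErasing p (λ ())) (fixed 0ℤ)
    where
    head : (w : Word s) → w ≢ [] → ((i : Fin (length w)) → u (0ℤ ℤ.+ ℤ.+ toℕ i) ≡ lookup w i) →
      ∃ λ r → w ≡ u 0ℤ ∷ r
    head []      w≢[] _ = ⊥-elim (w≢[] refl)
    head (c ∷ w) _    f = w , cong (_∷ w) (sym (f fzero))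

  fixed-point-last : ∃ λ r → powW η p [ u -[1+ 0 ] ] ≡ r ++ [ u -[1+ 0 ] ]
  fixed-point-last = last-from-lookup w (u -[1+ 0 ]) w≢[]
    (λ i i≡ → trans (cong u (sym (position i i≡))) (fixed -[1+ 0 ] i))
    where
    w = powW η p [ u -[1+ 0 ] ]
    w≢[] : w ≢ []
    w≢[] = powW-≢[] η nonErasing p (λ ())
    position : (i : Fin (length w)) → toℕ i ≡ length w ∸ 1 →
      ℤ.- (ℤ.+ length (w ++ [])) ℤ.+ ℤ.+ toℕ i ≡ -[1+ 0 ]
    position i i≡ = trans (cong₂ (λ l j → ℤ.- (ℤ.+ l) ℤ.+ ℤ.+ j) (cong length (++-identityʳ w)) i≡)
      (-m+[m∸1]≡-1 (length w) (≢[]⇒1≤length w≢[]))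

module _ {s : ℕ} {η : Morph s} {u : Seq s} {p : ℕ} where

  rep-neg≺rep-nonneg : ∀ {n n′ w w′} → Rep η u p -[1+ n ] w → Rep η u p (ℤ.+ n′) w′ → w ≺ w′
  rep-neg≺rep-nonneg rep-minus-one                  rep-zero                      = neg<pos _ _
  rep-neg≺rep-nonneg rep-minus-one                  (rep-pos _ _ _ _ _ _ _ _ _)   = neg<pos _ _
  rep-neg≺rep-nonneg (rep-neg _ _ _ _ _ _ _ _ _ _)  rep-zero                      = neg<pos _ _
  rep-neg≺rep-nonneg (rep-neg _ _ _ _ _ _ _ _ _ _)  (rep-pos _ _ _ _ _ _ _ _ _)   = neg<pos _ _

  module _ (nonErasing : ∀ c → η c ≢ []) (1≤p : 1 ≤ p) (fixed : IsFixedBy η p u) where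

    rep-nonneg-monotone : ∀ {n n′ w w′} → n < n′ → Rep η u p (ℤ.+ n) w → Rep η u p (ℤ.+ n′) w′ → w ≺ w′
    rep-nonneg-monotone ()  rep-zero rep-zero
    rep-nonneg-monotone _   rep-zero (rep-pos _ _ m _ _ 1≤k _ _ _) = pos<pos _ _ (inj₁ (s≤s (0<length-digits m 1≤k)))
    rep-nonneg-monotone ()  (rep-pos _ _ _ _ _ _ _ _ _) rep-zero
    rep-nonneg-monotone lt  (rep-pos _ _ _ _ p∣k _ adm normalised segment≡) (rep-pos _ _ _ _ p∣k′ _ adm′ _ segment≡′) =
      positive-digits-≺ η nonErasing 1≤p (fixed-point-head {p = p} {u} nonErasing fixed) p∣k p∣k′ adm normalised adm′
        (subst₂ _<_ (sym (length-segment≡ segment≡)) (sym (length-segment≡ segment≡′)) lt)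

    rep-neg-monotone : ∀ {n n′ w w′} → n′ < n → Rep η u p -[1+ n ] w → Rep η u p -[1+ n′ ] w′ → w ≺ w′
    rep-neg-monotone ()  rep-minus-one rep-minus-one
    rep-neg-monotone ()  rep-minus-one (rep-neg _ _ _ _ _ _ _ _ _ _)
    rep-neg-monotone _   (rep-neg _ _ m _ _ 1≤k _ _ _ _) rep-minus-one = neg<neg _ _ (inj₁ (s≤s (0<length-digits m 1≤k)))
    rep-neg-monotone lt  (rep-neg _ _ _ _ p∣k _ adm _ _ position) (rep-neg _ _ _ _ p∣k′ _ adm′ normalised′ _ position′) =
      negative-digits-≺ η 1≤p (fixed-point-last {p = p} {u} nonErasing fixed) p∣k p∣k′ adm adm′ normalised′
        (-m+n≡-[1+j]⇒n+1+j≡m _ _ position) (-m+n≡-[1+j]⇒n+1+j≡m _ _ position′) (s≤s lt)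

-- The growing seed only makes rep_u total.
proposition20 : (s : ℕ) (η : Morph s) → Substitution η →
    (u : Seq s) (p : ℕ) → Period η u p → GrowingSeed η u →
    (n n′ : ℤ) (w w′ : List ℕ) → n ℤ.< n′ →
    Rep η u p n w → Rep η u p n′ w′ → w ≺ w′
proposition20 s η sub u p period _ _ _ _ _ -<+ r r′ = rep-neg≺rep-nonneg r r′
proposition20 s η sub u p (1≤p , fixed , _) _ _ _ _ _ (-<- n′<n) r r′ =
  rep-neg-monotone (Substitution.nonErasing sub) 1≤p fixed n′<n r r′
proposition20 s η sub u p (1≤p , fixed , _) _ _ _ _ _ (+<+ n<n′) r r′ =
  rep-nonneg-monotone (Substitution.nonErasing sub) 1≤p fixed n<n′ r r′
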